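{- Let $\Sigma,\Gamma$ be finite alphabets with at least two letters each and $\mathcal{I}$ the set of injective morphisms $\Sigma^*\to\Gamma^*$. Let $w\in\Sigma^*$. If there exist $h\in\mathcal{I}$, a word $x\in\Gamma^*$, a rational $r\ge1$ and a letter $a\in\Gamma$ such that $h(w)=x^r$ and $a$ occurs exactly once in $x$, then $\mathrm{E}_{\mathcal{I}}(w)=\infty$.
   Context: For a nonempty word $v$ and natural number $p$, $v^{p/|v|}$ is the prefix of length $p$ of $vvv\cdots$. The fractional exponent of a nonempty word $u$ is $\mathrm{E}(u)=\sup\{r\in\mathbb{Q}\mid\exists v\ne\varepsilon: u=v^r\}$, and $\mathrm{E}_{\mathcal{I}}(u)=\sup\{\mathrm{E}(h(u))\mid h\in\mathcal{I}\}$. -}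

module Defs where

open import Data.Nat using (ℕ; zero; suc; _+_)
open import Data.Fin using (Fin; _≟_)
open import Data.List using (List; []; _∷_; _++_; take; concat; replicate; length; concatMap)
open import Data.Integer using (+_)
open import Data.Rational using (ℚ; _/_; _≤_; _<_; 1ℚ)
open import Data.Product using (Σ; ∃; _×_; _,_)
open import Relation.Binary.PropositionalEquality using (_≡_)
open import Relation.Nullary using (yes; no)

Word : ℕ → Set
Word k = List (Fin k)

-- A morphism Σ* → Γ* is determined by the images of the letters.
Morphism : ℕ → ℕ → Set
Morphism m n = Fin m → Word n

apply : ∀ {m n} → Morphism m n → Word m → Word n
apply h w = concatMap h w

Injective : ∀ {m n} → Morphism m n → Set
Injective {m} h = ∀ (u v : Word m) → apply h u ≡ apply h v → u ≡ v

-- v^{p/|v|} : the prefix of length p of v v v ⋯ (v nonempty, so p copies suffice).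
prefixOfPowers : ∀ {k} → Word k → ℕ → Word k
prefixOfPowers v p = take p (concat (replicate p v))

IsFracPower : ∀ {k} → Word k → Word k → ℚ → Set
IsFracPower {k} u v r =
  Σ (Fin k) λ c → Σ (Word k) λ v′ → v ≡ c ∷ v′ ×
    Σ ℕ λ p → r ≡ (+ p) / length (c ∷ v′) × u ≡ prefixOfPowers v p

occurrences : ∀ {k} → Fin k → Word k → ℕ
occurrences a [] = 0
occurrences a (b ∷ x) with a ≟ b
... | yes _ = suc (occurrences a x)
... | no _  = occurrences a x

-- E_𝓘(w) = ∞ : the set {E(h(w)) | h ∈ 𝓘} is unbounded, i.e. for every rational
-- bound B there are h ∈ 𝓘, v ≠ ε and r > B with h(w) = v^r.
EIInfinite : ∀ {m} (n : ℕ) → Word m → Set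
EIInfinite {m} n w =
  ∀ (B : ℚ) → Σ (Morphism m n) λ h → Injective h ×
    Σ (Word n) λ v → Σ ℚ λ r → B < r × IsFracPower (apply h w) v r

-- Write x = y a z with a ∉ y z, and let g be the morphism inserting (z y a)^N
-- after the letter a and fixing every other letter.  Every g-image of a letter
-- starts with that letter, so g is injective, and g(x) = y a (z y a)^N z = x^(N+1).
-- Since h(w) is a prefix of x^ω beginning with x, g(h(w)) is a prefix of x^ω of
-- length at least (N+1)|x|, i.e. a power of x of exponent at least N+1; N is
-- arbitrary, so g ∘ h witnesses unbounded exponents.
module Submission where

open import Defs
open import Data.Nat using (ℕ; zero; suc; _+_; _*_; _∸_; _≤_; s≤s; z<s; NonZero)
import Data.Nat.Properties as ℕ
open import Data.Fin using (Fin; _≟_)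
open import Data.List using (List; []; _∷_; _++_; _∷ʳ_; take; drop; concat; replicate; length)
open import Data.List.Properties
  using (++-assoc; ++-identityʳ; ++-cancelˡ; ∷-injective; length-++; concatMap-++; take-all; take++drop≡id)
import Data.Integer as ℤ
import Data.Integer.Properties as ℤ
open import Data.Rational using (ℚ; mkℚ; 1ℚ; _/_; _<_; toℚᵘ) renaming (_≤_ to _≤ℚ_)
import Data.Rational.Properties as ℚ
open import Data.Rational.Unnormalised as ℚᵘ using (mkℚᵘ; *≤*; *<*)
import Data.Rational.Unnormalised.Properties as ℚᵘ
open import Data.Product using (Σ; _×_; _,_)
open import Data.Empty using (⊥-elim)
open import Relation.Nullary using (yes; no)
open import Relation.Binary.PropositionalEquality
  using (_≡_; refl; sym; trans; cong; cong₂; subst; module ≡-Reasoning)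

module _ {A : Set} where

  infixr 8 _^_

  _^_ : List A → ℕ → List A
  x ^ j = concat (replicate j x)

  ^-+ : ∀ (x : List A) i j → x ^ (i + j) ≡ x ^ i ++ x ^ j
  ^-+ x zero    j = refl
  ^-+ x (suc i) j = trans (cong (x ++_) (^-+ x i j)) (sym (++-assoc x (x ^ i) (x ^ j)))

  ^-* : ∀ (x : List A) i j → (x ^ i) ^ j ≡ x ^ (j * i)
  ^-* x i zero    = refl
  ^-* x i (suc j) = trans (cong (x ^ i ++_) (^-* x i j)) (sym (^-+ x i (j * i)))

  length-^ : ∀ (x : List A) j → length (x ^ j) ≡ j * length x
  length-^ x zero    = refl
  length-^ x (suc j) = trans (length-++ x) (cong (length x +_) (length-^ x j))

  ^-conjugate : ∀ (s t : List A) j → (s ++ t) ^ j ++ s ≡ s ++ (t ++ s) ^ j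
  ^-conjugate s t zero    = sym (++-identityʳ s)
  ^-conjugate s t (suc j) = begin
    ((s ++ t) ++ (s ++ t) ^ j) ++ s  ≡⟨ ++-assoc (s ++ t) _ s ⟩
    (s ++ t) ++ ((s ++ t) ^ j ++ s)  ≡⟨ cong ((s ++ t) ++_) (^-conjugate s t j) ⟩
    (s ++ t) ++ (s ++ (t ++ s) ^ j)  ≡⟨ ++-assoc s t _ ⟩
    s ++ (t ++ (s ++ (t ++ s) ^ j))  ≡⟨ cong (s ++_) (sym (++-assoc t s _)) ⟩
    s ++ (t ++ s) ^ suc j            ∎
    where open ≡-Reasoning

  take-++ˡ : ∀ n (xs ys : List A) → n ≤ length xs → take n (xs ++ ys) ≡ take n xs
  take-++ˡ zero    xs       ys _         = refl
  take-++ˡ (suc n) (x ∷ xs) ys (s≤s n≤∣xs∣) = cong (x ∷_) (take-++ˡ n xs ys n≤∣xs∣)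

  take-++ʳ : ∀ n (xs ys : List A) → length xs ≤ n → take n (xs ++ ys) ≡ xs ++ take (n ∸ length xs) ys
  take-++ʳ n       []       ys _         = refl
  take-++ʳ (suc n) (x ∷ xs) ys (s≤s ∣xs∣≤n) = cong (x ∷_) (take-++ʳ n xs ys ∣xs∣≤n)

  take-length-++ : ∀ (xs ys : List A) → take (length xs) (xs ++ ys) ≡ xs
  take-length-++ xs ys = trans (take-++ˡ (length xs) xs ys ℕ.≤-refl) (take-all (length xs) xs ℕ.≤-refl)

module _ {k : ℕ} where

  prefix-of-^ : ∀ (x : Word k) .{{_ : NonZero (length x)}} (s t : Word k) j →
                s ++ t ≡ x ^ j → s ≡ prefixOfPowers x (length s)
  prefix-of-^ x s t j s++t≡ = begin
    s                                 ≡⟨ sym (take-length-++ s (t ++ x ^ L)) ⟩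
    take L (s ++ (t ++ x ^ L))        ≡⟨ cong (take L) (sym (++-assoc s t (x ^ L))) ⟩
    take L ((s ++ t) ++ x ^ L)        ≡⟨ cong (λ u → take L (u ++ x ^ L)) s++t≡ ⟩
    take L (x ^ j ++ x ^ L)           ≡⟨ cong (take L) (sym (^-+ x j L)) ⟩
    take L (x ^ (j + L))              ≡⟨ cong (λ i → take L (x ^ i)) (ℕ.+-comm j L) ⟩
    take L (x ^ (L + j))              ≡⟨ cong (take L) (^-+ x L j) ⟩
    take L (x ^ L ++ x ^ j)           ≡⟨ take-++ˡ L (x ^ L) (x ^ j) L≤ ⟩
    take L (x ^ L)                    ∎
    where
      open ≡-Reasoning
      L = length s
      L≤ : L ≤ length (x ^ L)
      L≤ = subst (L ≤_) (sym (length-^ x L)) (ℕ.m≤m*n L (length x))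

  prefixOfPowers-≥ : ∀ (x : Word k) p → length x ≤ p →
                     Σ (Word k) λ t → prefixOfPowers x p ≡ x ++ t
  prefixOfPowers-≥ []      p       _   = prefixOfPowers [] p , refl
  prefixOfPowers-≥ (c ∷ v) (suc p) |x|≤ = _ , take-++ʳ (suc p) (c ∷ v) ((c ∷ v) ^ p) |x|≤

module _ {m k : ℕ} where

  apply-++ : ∀ (h : Morphism m k) u v → apply h (u ++ v) ≡ apply h u ++ apply h v
  apply-++ h = concatMap-++ h

  apply-^ : ∀ (h : Morphism m k) x j → apply h (x ^ j) ≡ apply h x ^ j
  apply-^ h x zero    = refl
  apply-^ h x (suc j) = trans (apply-++ h x (x ^ j)) (cong (apply h x ++_) (apply-^ h x j))

infixr 9 _⊙_

_⊙_ : ∀ {m k l} → Morphism k l → Morphism m k → Morphism m l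
(g ⊙ h) b = apply g (h b)

apply-⊙ : ∀ {m k l} (g : Morphism k l) (h : Morphism m k) w → apply (g ⊙ h) w ≡ apply g (apply h w)
apply-⊙ g h []      = refl
apply-⊙ g h (b ∷ w) = trans (cong (apply g (h b) ++_) (apply-⊙ g h w)) (sym (apply-++ g (h b) (apply h w)))

⊙-injective : ∀ {m k l} {g : Morphism k l} {h : Morphism m k} → Injective g → Injective h → Injective (g ⊙ h)
⊙-injective {g = g} {h} g-inj h-inj u v e =
  h-inj u v (g-inj _ _ (trans (sym (apply-⊙ g h u)) (trans e (apply-⊙ g h v))))

module _ {k : ℕ} where

  -- Each image g(b) = b t(b) starts with b, so g(u) determines the first letter of u.
  letterLed-injective : ∀ (t : Fin k → Word k) → Injective (λ b → b ∷ t b)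
  letterLed-injective t []      []       _ = refl
  letterLed-injective t []      (_ ∷ _)  ()
  letterLed-injective t (_ ∷ _) []       ()
  letterLed-injective t (b ∷ u) (b′ ∷ v) e with ∷-injective e
  ... | refl , e′ = cong (b ∷_) (letterLed-injective t u v (++-cancelˡ (t b) _ _ e′))

  module _ (a : Fin k) where

    occurrences≡1⇒split : ∀ (x : Word k) → occurrences a x ≡ 1 →
      Σ (Word k) λ y → Σ (Word k) λ z →
        x ≡ y ++ a ∷ z × occurrences a y ≡ 0 × occurrences a z ≡ 0
    occurrences≡1⇒split []      ()
    occurrences≡1⇒split (b ∷ x) once with a ≟ b
    ... | yes refl = [] , x , refl , refl , ℕ.suc-injective once
    ... | no  a≢b with occurrences≡1⇒split x once
    ...   | y , z , refl , a∉y , a∉z = b ∷ y , z , refl , a∉by , a∉z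
      where
        a∉by : occurrences a (b ∷ y) ≡ 0
        a∉by with a ≟ b
        ... | yes a≡b = ⊥-elim (a≢b a≡b)
        ... | no  _   = a∉y

    insertion : Word k → Fin k → Word k
    insertion s b with a ≟ b
    ... | yes _ = s
    ... | no  _ = []

    insertAfter : Word k → Morphism k k
    insertAfter s b = b ∷ insertion s b

    insertAfter-injective : ∀ s → Injective (insertAfter s)
    insertAfter-injective s = letterLed-injective (insertion s)

    insertAfter-fixes : ∀ s (y : Word k) → occurrences a y ≡ 0 → apply (insertAfter s) y ≡ y
    insertAfter-fixes s []      _   = refl
    insertAfter-fixes s (b ∷ y) a∉ with a ≟ b
    ... | yes refl = ⊥-elim (ℕ.1+n≢0 a∉)
    ... | no  _    = cong (b ∷_) (insertAfter-fixes s y a∉)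

    insertAfter-a : ∀ s → insertAfter s a ≡ a ∷ s
    insertAfter-a s with a ≟ a
    ... | yes _   = refl
    ... | no  a≢a = ⊥-elim (a≢a refl)

    insertAfter-unique : ∀ s (y z : Word k) → occurrences a y ≡ 0 → occurrences a z ≡ 0 →
                         apply (insertAfter s) (y ++ a ∷ z) ≡ y ++ a ∷ s ++ z
    insertAfter-unique s y z a∉y a∉z = begin
      apply g (y ++ a ∷ z)             ≡⟨ apply-++ g y (a ∷ z) ⟩
      apply g y ++ g a ++ apply g z    ≡⟨ cong₂ (λ y′ z′ → y′ ++ g a ++ z′) (insertAfter-fixes s y a∉y)
                                                                        (insertAfter-fixes s z a∉z) ⟩
      y ++ g a ++ z                    ≡⟨ cong (λ u → y ++ u ++ z) (insertAfter-a s) ⟩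
      y ++ a ∷ s ++ z                  ∎
      where
        open ≡-Reasoning
        g = insertAfter s

    pumping : ∀ (y z : Word k) → occurrences a y ≡ 0 → occurrences a z ≡ 0 → ∀ N →
              apply (insertAfter ((z ++ y ∷ʳ a) ^ N)) (y ++ a ∷ z) ≡ (y ++ a ∷ z) ^ suc N
    pumping y z a∉y a∉z N = begin
      apply (insertAfter ((z ++ y ∷ʳ a) ^ N)) x ≡⟨ insertAfter-unique _ y z a∉y a∉z ⟩
      y ++ a ∷ (z ++ y ∷ʳ a) ^ N ++ z           ≡⟨ cong (λ u → y ++ a ∷ u) (^-conjugate z (y ∷ʳ a) N) ⟩
      y ++ a ∷ z ++ (y ∷ʳ a ++ z) ^ N           ≡⟨ cong (λ u → y ++ a ∷ z ++ u ^ N) (++-assoc y (a ∷ []) z) ⟩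
      y ++ (a ∷ z) ++ x ^ N                     ≡⟨ sym (++-assoc y (a ∷ z) (x ^ N)) ⟩
      x ^ suc N                                 ∎
      where
        open ≡-Reasoning
        x = y ++ a ∷ z

  pump-prefixOfPowers : ∀ (g : Morphism k k) (x : Word k) .{{_ : NonZero (length x)}} N →
    apply g x ≡ x ^ suc N → ∀ p → length x ≤ p →
    Σ ℕ λ L → apply g (prefixOfPowers x p) ≡ prefixOfPowers x L × suc N * length x ≤ L
  pump-prefixOfPowers g x N gx≡ p |x|≤p = length (apply g u) , is-prefix , long
    where
      u = prefixOfPowers x p
      is-prefix : apply g u ≡ prefixOfPowers x (length (apply g u))
      is-prefix = prefix-of-^ x (apply g u) (apply g (drop p (x ^ p))) (p * suc N) (begin
        apply g u ++ apply g (drop p (x ^ p)) ≡⟨ sym (apply-++ g u _) ⟩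
        apply g (u ++ drop p (x ^ p))         ≡⟨ cong (apply g) (take++drop≡id p (x ^ p)) ⟩
        apply g (x ^ p)                       ≡⟨ apply-^ g x p ⟩
        apply g x ^ p                         ≡⟨ cong (_^ p) gx≡ ⟩
        (x ^ suc N) ^ p                       ≡⟨ ^-* x (suc N) p ⟩
        x ^ (p * suc N)                       ∎)
        where open ≡-Reasoning
      long : suc N * length x ≤ length (apply g u)
      long with prefixOfPowers-≥ x p |x|≤p
      ... | t , u≡x++t = begin
        suc N * length x                       ≡⟨ sym (length-^ x (suc N)) ⟩
        length (x ^ suc N)                     ≤⟨ ℕ.m≤m+n _ _ ⟩
        length (x ^ suc N) + length (apply g t) ≡⟨ sym (length-++ (x ^ suc N)) ⟩
        length (x ^ suc N ++ apply g t)        ≡⟨ cong (λ s → length (s ++ apply g t)) (sym gx≡) ⟩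
        length (apply g x ++ apply g t)        ≡⟨ cong length (sym (apply-++ g x t)) ⟩
        length (apply g (x ++ t))              ≡⟨ cong (λ s → length (apply g s)) (sym u≡x++t) ⟩
        length (apply g u)                     ∎
        where open ℕ.≤-Reasoning

unbounded-powers : ∀ {m k} (h : Morphism m k) → Injective h → (w : Word m)
  (x : Word k) .{{_ : NonZero (length x)}} (a : Fin k) (p : ℕ) →
  apply h w ≡ prefixOfPowers x p → length x ≤ p → occurrences a x ≡ 1 → ∀ N →
  Σ (Morphism m k) λ h′ → Injective h′ ×
    Σ ℕ λ L → apply h′ w ≡ prefixOfPowers x L × suc N * length x ≤ L
unbounded-powers h h-inj w x a p hw≡ |x|≤p a-once N with occurrences≡1⇒split a x a-once
... | y , z , x≡yaz , a∉y , a∉z =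
  let (L , gu≡ , long) = pump-prefixOfPowers g x N gx≡ p |x|≤p
  in g ⊙ h , ⊙-injective (insertAfter-injective a _) h-inj ,
     L , trans (apply-⊙ g h w) (trans (cong (apply g) hw≡) gu≡) , long
  where
    g = insertAfter a ((z ++ y ∷ʳ a) ^ N)
    gx≡ : apply g x ≡ x ^ suc N
    gx≡ = subst (λ x′ → apply g x′ ≡ x′ ^ suc N) (sym x≡yaz) (pumping a y z a∉y a∉z N)

toℚᵘ-/suc : ∀ i l → toℚᵘ (i / suc l) ℚᵘ.≃ mkℚᵘ i l
toℚᵘ-/suc i l = ℚ.toℚᵘ-fromℚᵘ (mkℚᵘ i l)

1≤p/q⇒q≤p : ∀ p q .{{_ : NonZero q}} → 1ℚ ≤ℚ ℤ.+ p / q → q ≤ p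
1≤p/q⇒q≤p p (suc l) 1≤p/q with ℚᵘ.≤-respʳ-≃ (toℚᵘ-/suc (ℤ.+ p) l) (ℚ.toℚᵘ-mono-≤ 1≤p/q)
... | *≤* 1*q≤p*1 = ℤ.drop‿+≤+ (begin
  ℤ.+ suc l               ≡⟨ ℤ.*-identityˡ (ℤ.+ suc l) ⟨
  ℤ.+ 1 ℤ.* ℤ.+ suc l     ≤⟨ 1*q≤p*1 ⟩
  ℤ.+ p ℤ.* ℤ.+ 1         ≡⟨ ℤ.*-identityʳ (ℤ.+ p) ⟩
  ℤ.+ p                   ∎)
  where open ℤ.≤-Reasoning

i≤+∣i∣ : ∀ (i : ℤ.ℤ) → i ℤ.≤ ℤ.+ ℤ.∣ i ∣
i≤+∣i∣ (ℤ.+ n)     = ℤ.≤-refl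
i≤+∣i∣ ℤ.-[1+ n ] = ℤ.-≤+

p/q-unbounded : ∀ (B : ℚ) → Σ ℕ λ N → ∀ L q .{{_ : NonZero q}} → suc N * q ≤ L → B < ℤ.+ L / q
p/q-unbounded B@(mkℚ num d _) = ℤ.∣ num ∣ , above
  where
    cross : ∀ L l → suc ℤ.∣ num ∣ * suc l ≤ L → num ℤ.* ℤ.+ suc l ℤ.< ℤ.+ L ℤ.* ℤ.+ suc d
    cross L l sucN*q≤L = begin-strict
      num ℤ.* ℤ.+ suc l            ≤⟨ ℤ.*-monoʳ-≤-nonNeg (ℤ.+ suc l) (i≤+∣i∣ num) ⟩
      ℤ.+ ℤ.∣ num ∣ ℤ.* ℤ.+ suc l  ≡⟨ ℤ.pos-* ℤ.∣ num ∣ (suc l) ⟨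
      ℤ.+ (ℤ.∣ num ∣ * suc l)      <⟨ ℤ.+<+ (ℕ.<-≤-trans (ℕ.m<n+m _ z<s) sucN*q≤L) ⟩
      ℤ.+ L                        ≤⟨ ℤ.+≤+ (ℕ.m≤m*n L (suc d)) ⟩
      ℤ.+ (L * suc d)              ≡⟨ ℤ.pos-* L (suc d) ⟩
      ℤ.+ L ℤ.* ℤ.+ suc d          ∎
      where open ℤ.≤-Reasoning
    above : ∀ L q .{{_ : NonZero q}} → suc ℤ.∣ num ∣ * q ≤ L → B < ℤ.+ L / q
    above L (suc l) sucN*q≤L = ℚ.toℚᵘ-cancel-<
      (ℚᵘ.<-respʳ-≃ (ℚᵘ.≃-sym (toℚᵘ-/suc (ℤ.+ L) l)) (*<* (cross L l sucN*q≤L)))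

mainTheorem15 : (m n : ℕ) → 2 ≤ m → 2 ≤ n → (w : Word m) →
    Σ (Morphism m n) (λ h → Injective h ×
      Σ (Word n) (λ x → Σ ℚ (λ r → Σ (Fin n) (λ a →
        IsFracPower (apply h w) x r × 1ℚ ≤ℚ r × occurrences a x ≡ 1)))) →
    EIInfinite n w
mainTheorem15 m n _ _ w (h , h-inj , .(c ∷ v) , _ , a , (c , v , refl , p , refl , hw≡) , 1≤r , a-once) B =
  let x = c ∷ v
      (N , B<) = p/q-unbounded B
      (h′ , h′-inj , L , h′w≡ , long) =
        unbounded-powers h h-inj w x a p hw≡ (1≤p/q⇒q≤p p (length x) 1≤r) a-once N
  in h′ , h′-inj , x , ℤ.+ L / length x , B< L (length x) long , c , v , refl , L , refl , h′w≡
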